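{- Let $\ell\ge 6$ be an integer and let $w$ be a subscript-increasing word over $\Sigma_8$. If $\varphi(w)$ contains (as a factor) a $5/4$-power of length $5\ell$, then $\ell$ is divisible by $6$.
   Context: Let $\Sigma_8=\{n_j : n\in\mathbb{Z},\ 0\le j\le 7\}$ be the infinite alphabet of distinct formal symbols $n_j$. Let $\varphi$ be the $6$-uniform morphism on $\Sigma_8$ (extended to words by concatenation) defined for all $n\in\mathbb{Z}$ by $\varphi(n_0)=0_0 1_1 0_2 0_3 1_4 (n+3)_5$, $\varphi(n_1)=1_6 1_7 0_0 0_1 0_2 (n+2)_3$, $\varphi(n_2)=1_4 1_5 1_6 0_7 0_0 (n+3)_1$, $\varphi(n_3)=0_2 1_3 1_4 0_5 1_6 (n+2)_7$, $\varphi(n_4)=0_0 1_1 0_2 0_3 1_4 (n+1)_5$, $\varphi(n_5)=1_6 1_7 0_0 0_1 0_2 (n+2)_3$, $\varphi(n_6)=1_4 1_5 1_6 0_7 0_0 (n+1)_1$, $\varphi(n_7)=0_2 1_3 1_4 0_5 1_6 (n+2)_7$. A word over $\Sigma_8$ is subscript-increasing if the subscripts of consecutive letters increase by $1$ modulo $8$. A $5/4$-power is a word $xyx$ with $|x|\ge1$ and $|y|=3|x|$ (its length is $5|x|$). -}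

module Defs where

open import Data.Nat using (ℕ; suc; _+_; _*_; _%_)
open import Data.Integer as ℤ using (ℤ; +_)
open import Data.Fin using (Fin; toℕ; zero; suc; #_)
open import Data.Product using (_×_; _,_; Σ; ∃-syntax)
open import Data.List using (List; []; _∷_; _++_; length; concatMap)
open import Relation.Binary.PropositionalEquality using (_≡_)

-- The letter n_j is represented as the pair (n , j).
Letter : Set
Letter = ℤ × Fin 8

Word : Set
Word = List Letter

l : ℕ → Fin 8 → Letter
l n j = (+ n , j)

φ₁ : Letter → Word
φ₁ (n , zero) =
  l 0 (# 0) ∷ l 1 (# 1) ∷ l 0 (# 2) ∷ l 0 (# 3) ∷ l 1 (# 4) ∷ (n ℤ.+ + 3 , # 5) ∷ []
φ₁ (n , suc zero) =
  l 1 (# 6) ∷ l 1 (# 7) ∷ l 0 (# 0) ∷ l 0 (# 1) ∷ l 0 (# 2) ∷ (n ℤ.+ + 2 , # 3) ∷ []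
φ₁ (n , suc (suc zero)) =
  l 1 (# 4) ∷ l 1 (# 5) ∷ l 1 (# 6) ∷ l 0 (# 7) ∷ l 0 (# 0) ∷ (n ℤ.+ + 3 , # 1) ∷ []
φ₁ (n , suc (suc (suc zero))) =
  l 0 (# 2) ∷ l 1 (# 3) ∷ l 1 (# 4) ∷ l 0 (# 5) ∷ l 1 (# 6) ∷ (n ℤ.+ + 2 , # 7) ∷ []
φ₁ (n , suc (suc (suc (suc zero)))) =
  l 0 (# 0) ∷ l 1 (# 1) ∷ l 0 (# 2) ∷ l 0 (# 3) ∷ l 1 (# 4) ∷ (n ℤ.+ + 1 , # 5) ∷ []
φ₁ (n , suc (suc (suc (suc (suc zero))))) =
  l 1 (# 6) ∷ l 1 (# 7) ∷ l 0 (# 0) ∷ l 0 (# 1) ∷ l 0 (# 2) ∷ (n ℤ.+ + 2 , # 3) ∷ []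
φ₁ (n , suc (suc (suc (suc (suc (suc zero)))))) =
  l 1 (# 4) ∷ l 1 (# 5) ∷ l 1 (# 6) ∷ l 0 (# 7) ∷ l 0 (# 0) ∷ (n ℤ.+ + 1 , # 1) ∷ []
φ₁ (n , suc (suc (suc (suc (suc (suc (suc zero))))))) =
  l 0 (# 2) ∷ l 1 (# 3) ∷ l 1 (# 4) ∷ l 0 (# 5) ∷ l 1 (# 6) ∷ (n ℤ.+ + 2 , # 7) ∷ []

φ : Word → Word
φ = concatMap φ₁

data SubscriptIncreasing : Word → Set where
  []  : SubscriptIncreasing []
  [_] : (a : Letter) → SubscriptIncreasing (a ∷ [])
  _∷_ : ∀ {a b w} →
        toℕ (Data.Product.proj₂ b) ≡ (suc (toℕ (Data.Product.proj₂ a))) % 8 →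
        SubscriptIncreasing (b ∷ w) → SubscriptIncreasing (a ∷ b ∷ w)

Factor : Word → Word → Set
Factor u v = Σ Word λ p → Σ Word λ s → v ≡ p ++ u ++ s

FiveQuarterPower : ℕ → Word → Set
FiveQuarterPower ℓ u =
  Σ Word λ x → Σ Word λ y →
    (1 Data.Nat.≤ ℓ) × (length x ≡ ℓ) × (length y ≡ 3 * ℓ) × (u ≡ x ++ y ++ x)

-- Position q of φ(w) is predicted, once the first subscript of w is fixed, by a template
-- whose subscripts have period 8 and whose values have period 24; only the value of the
-- last letter of each block φ(a) is left open. The two copies of x in a 5/4-power xyx
-- sit 4ℓ apart, so the template must be consistent with itself on a window of six
-- positions under a shift by 4ℓ. A finite check shows that this forces 24 ∣ 4ℓ.

module Submission where

open import Defs
open import Data.Nat using (ℕ; _≤_)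
open import Data.Nat.Divisibility using (_∣_)
open import Data.Product using (Σ; _×_)

open import Data.Nat using (zero; suc; _+_; _*_; _%_; _/_; _<_; _≟_; s≤s)
open import Data.Nat.Properties using (+-identityʳ; +-suc; *-assoc; allUpTo?)
open import Data.Nat.DivMod using (_mod_; m≡m%n+[m/n]*n; [m+kn]%n≡m%n; m%n<n)
open import Data.Nat.Divisibility using (m%n≡0⇒n∣m; *-cancelˡ-∣)
open import Data.Nat.Tactic.RingSolver using (solve-∀)
import Data.Integer as ℤ
open import Data.Integer.Properties using (+-injective)
open import Data.Fin using (toℕ)
open import Data.Fin.Patterns using (0F; 1F; 2F; 3F; 4F; 5F; 6F; 7F)
open import Data.Fin.Properties using (fromℕ<-cong)
open import Data.Maybe using (Maybe; just; nothing)
import Data.Maybe.Relation.Unary.All as Maybe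
open import Data.Vec using (Vec; []; _∷_; lookup)
open import Data.List using ([]; _∷_; _++_; length)
open import Data.Product using (_,_; proj₁; proj₂)
open import Data.Unit using (⊤; tt)
open import Relation.Nullary.Decidable using (Dec; yes; _×-dec_; _→-dec_; toWitness)
open import Relation.Binary.PropositionalEquality

Cell : Set
Cell = Maybe ℕ × ℕ

blockValues : Vec (Maybe ℕ) 24
blockValues =
  just 0 ∷ just 1 ∷ just 0 ∷ just 0 ∷ just 1 ∷ nothing ∷
  just 1 ∷ just 1 ∷ just 0 ∷ just 0 ∷ just 0 ∷ nothing ∷
  just 1 ∷ just 1 ∷ just 1 ∷ just 0 ∷ just 0 ∷ nothing ∷
  just 0 ∷ just 1 ∷ just 1 ∷ just 0 ∷ just 1 ∷ nothing ∷ []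

-- template q describes position q of φ(w) for w starting with subscript 0: φ(n_j) and
-- φ(n_{j+4}) agree except in their last letter, whose value depends on n (nothing).
template : ℕ → Cell
template q = lookup blockValues (q mod 24) , q % 8

template-periodic : ∀ q k → template (q + k * 24) ≡ template q
template-periodic q k = cong₂ _,_
  (cong (lookup blockValues)
    (fromℕ<-cong _ (q % 24) ([m+kn]%n≡m%n q k 24) (m%n<n (q + k * 24) 24) (m%n<n q 24)))
  (trans (cong (λ m → (q + m) % 8) (sym (*-assoc k 3 8))) ([m+kn]%n≡m%n q (k * 3) 8))

Fits : Letter → Cell → Set
Fits (n , j) (v , s) = toℕ j ≡ s × Maybe.All (λ b → n ≡ ℤ.+ b) v

FitsFrom : ℕ → Word → Set
FitsFrom q [] = ⊤
FitsFrom q (a ∷ u) = Fits a (template q) × FitsFrom (suc q) u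

FitsFrom-periodic : ∀ {q} k u → FitsFrom q u → FitsFrom (q + k * 24) u
FitsFrom-periodic k [] tt = tt
FitsFrom-periodic {q} k (a ∷ u) (fa , fu) =
  subst (Fits a) (sym (template-periodic q k)) fa , FitsFrom-periodic k u fu

FitsFrom-++⁻ : ∀ {q} u {v} → FitsFrom q (u ++ v) → FitsFrom q u × FitsFrom (q + length u) v
FitsFrom-++⁻ {q} [] {v} fv = tt , subst (λ q′ → FitsFrom q′ v) (sym (+-identityʳ q)) fv
FitsFrom-++⁻ {q} (a ∷ u) {v} (fa , fuv) with FitsFrom-++⁻ u fuv
... | fu , fv = (fa , fu) , subst (λ q′ → FitsFrom q′ v) (sym (+-suc q (length u))) fv

pattern fitsBlock fv =
  (refl , Maybe.just refl) , (refl , Maybe.just refl) , (refl , Maybe.just refl) ,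
  (refl , Maybe.just refl) , (refl , Maybe.just refl) , (refl , Maybe.nothing) , fv

φ₁-fits : ∀ a {v} → FitsFrom (6 * suc (toℕ (proj₂ a))) v →
          FitsFrom (6 * toℕ (proj₂ a)) (φ₁ a ++ v)
φ₁-fits (_ , 0F) fv = fitsBlock fv
φ₁-fits (_ , 1F) fv = fitsBlock fv
φ₁-fits (_ , 2F) fv = fitsBlock fv
φ₁-fits (_ , 3F) fv = fitsBlock fv
φ₁-fits (_ , 4F) fv = fitsBlock fv
φ₁-fits (_ , 5F) fv = fitsBlock fv
φ₁-fits (_ , 6F) fv = fitsBlock fv
φ₁-fits (_ , 7F) fv = fitsBlock fv

FitsFrom-6*[m%8] : ∀ m u → FitsFrom (6 * (m % 8)) u → FitsFrom (6 * m) u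
FitsFrom-6*[m%8] m u fu =
  subst (λ q → FitsFrom q u) shift (FitsFrom-periodic (m / 8 * 2) u fu)
  where
  shift : 6 * (m % 8) + m / 8 * 2 * 24 ≡ 6 * m
  shift = trans (regroup (m % 8) (m / 8)) (cong (6 *_) (sym (m≡m%n+[m/n]*n m 8)))
    where
    regroup : ∀ r k → 6 * r + k * 2 * 24 ≡ 6 * (r + k * 8)
    regroup = solve-∀

firstSubscript : Word → ℕ
firstSubscript [] = 0
firstSubscript ((_ , j) ∷ _) = toℕ j

φ-fits : ∀ {w} → SubscriptIncreasing w → FitsFrom (6 * firstSubscript w) (φ w)
φ-fits [] = tt
φ-fits [ a ] = φ₁-fits a tt
φ-fits (_∷_ {a} {b} {w} next si) =
  φ₁-fits a (FitsFrom-6*[m%8] (suc (toℕ (proj₂ a))) (φ (b ∷ w))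
    (subst (λ j → FitsFrom (6 * j) (φ (b ∷ w))) next (φ-fits si)))

Consistent : Cell → Cell → Set
Consistent (v , s) (v′ , s′) = s ≡ s′ × Maybe.All (λ b → Maybe.All (b ≡_) v′) v

consistent? : ∀ c c′ → Dec (Consistent c c′)
consistent? (v , s) (v′ , s′) = s ≟ s′ ×-dec Maybe.dec (λ b → Maybe.dec (b ≟_) v′) v

fits-consistent : ∀ {a c c′} → Fits a c → Fits a c′ → Consistent c c′
fits-consistent (refl , fv) (refl , fv′) =
  refl , Maybe.map (λ n≡b → Maybe.map (λ n≡c → +-injective (trans (sym n≡b) n≡c)) fv′) fv

ConsistentFor : ℕ → ℕ → ℕ → Set
ConsistentFor zero q q′ = ⊤
ConsistentFor (suc k) q q′ =
  Consistent (template q) (template q′) × ConsistentFor k (suc q) (suc q′)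

consistentFor? : ∀ k q q′ → Dec (ConsistentFor k q q′)
consistentFor? zero q q′ = yes tt
consistentFor? (suc k) q q′ =
  consistent? (template q) (template q′) ×-dec consistentFor? k (suc q) (suc q′)

ConsistentFor-periodic : ∀ k {q q′} i i′ →
  ConsistentFor k (q + i * 24) (q′ + i′ * 24) → ConsistentFor k q q′
ConsistentFor-periodic zero i i′ tt = tt
ConsistentFor-periodic (suc k) {q} {q′} i i′ (c , cs) =
  subst₂ Consistent (template-periodic q i) (template-periodic q′ i′) c ,
  ConsistentFor-periodic k i i′ cs

FitsFrom-consistent : ∀ k u {q q′} → k ≤ length u →
                      FitsFrom q u → FitsFrom q′ u → ConsistentFor k q q′
FitsFrom-consistent zero u _ _ _ = tt
FitsFrom-consistent (suc k) (a ∷ u) (s≤s k≤u) (fa , fu) (fa′ , fu′) =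
  fits-consistent fa fa′ , FitsFrom-consistent k u k≤u fu fu′

template-rigid-residues : ∀ {r} → r < 24 → ∀ {d} → d < 24 → ConsistentFor 6 r (r + d) → d ≡ 0
template-rigid-residues = toWitness {a? = allUpTo? (λ r →
  allUpTo? (λ d → consistentFor? 6 r (r + d) →-dec d ≟ 0) 24) 24} tt

template-rigid : ∀ P D → ConsistentFor 6 P (P + D) → D % 24 ≡ 0
template-rigid P D c =
  template-rigid-residues (m%n<n P 24) (m%n<n D 24)
    (ConsistentFor-periodic 6 {P % 24} {P % 24 + D % 24} (P / 24) (P / 24 + D / 24)
      (subst₂ (ConsistentFor 6) P≡ P+D≡ c))
  where
  P≡ : P ≡ P % 24 + P / 24 * 24
  P≡ = m≡m%n+[m/n]*n P 24
  regroup : ∀ r d k m → r + k * 24 + (d + m * 24) ≡ r + d + (k + m) * 24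
  regroup = solve-∀
  P+D≡ : P + D ≡ P % 24 + D % 24 + (P / 24 + D / 24) * 24
  P+D≡ = trans (cong₂ _+_ P≡ (m≡m%n+[m/n]*n D 24)) (regroup (P % 24) (D % 24) (P / 24) (D / 24))

power-windows : ∀ {q} x y → 6 ≤ length x → length y ≡ 3 * length x →
  FitsFrom q (x ++ y ++ x) → ConsistentFor 6 q (q + 4 * length x)
power-windows {q} x y 6≤x ∣y∣ fxyx with FitsFrom-++⁻ x fxyx
... | fx , fyx = FitsFrom-consistent 6 x 6≤x fx
  (subst (λ q′ → FitsFrom q′ x) second-x (proj₂ (FitsFrom-++⁻ y fyx)))
  where
  second-x : q + length x + length y ≡ q + 4 * length x
  second-x = trans (cong (q + length x +_) ∣y∣) (regroup q (length x))
    where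
    regroup : ∀ m n → m + n + 3 * n ≡ m + 4 * n
    regroup = solve-∀

lemma3p3 : (ℓ : ℕ) → 6 ≤ ℓ → (w : Word) → SubscriptIncreasing w →
    (Σ Word λ u → FiveQuarterPower ℓ u × Factor u (φ w)) → 6 ∣ ℓ
lemma3p3 _ 6≤ℓ w si (_ , (x , y , _ , refl , ∣y∣ , refl) , p , s , φw≡) =
  *-cancelˡ-∣ 4 (m%n≡0⇒n∣m (4 * length x) 24 (template-rigid P (4 * length x) windows))
  where
  P : ℕ
  P = 6 * firstSubscript w + length p
  fits : FitsFrom P (x ++ y ++ x)
  fits = proj₁ (FitsFrom-++⁻ (x ++ y ++ x)
           (proj₂ (FitsFrom-++⁻ p (subst (FitsFrom _) φw≡ (φ-fits si)))))
  windows : ConsistentFor 6 P (P + 4 * length x)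
  windows = power-windows x y 6≤ℓ ∣y∣ fits
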